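{- Let $n \ge 1$ and $m \ge 1$ be integers, and let $A_1,\dots,A_m, B_1,\dots,B_m \subseteq [n]=\{1,\dots,n\}$ be such that $\mathcal{P}=\{(A_i,B_i)\mid i\in[m]\}$ is a skew Bollobás system. Then $$\sum_{i=1}^m \frac{1}{(1+|A_i|+|B_i|)\binom{|A_i|+|B_i|}{|A_i|}} \le 1.$$
   Context: A family of pairs of sets $\mathcal{P}=\{(A_i,B_i)\mid i\in[m]\}$ is called a skew Bollobás system if (1) $A_i\cap B_i=\emptyset$ for every $i\in[m]$, and (2) $A_i\cap B_j\neq\emptyset$ whenever $i<j$. -}

module Defs where

open import Data.Nat using (ℕ; zero; suc; _+_; _*_; _<_; _>_; NonZero; z<s; >-nonZero)
open import Data.Nat.Properties using (+-suc; m*n≢0; m≤m+n; <-≤-trans)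
open import Data.Nat.Combinatorics using (_C_; nCk+nC[k+1]≡[n+1]C[k+1])
open import Data.Fin using (Fin; zero; suc; _<_)
open import Data.Fin.Subset using (Subset; _∩_; ∣_∣; Empty; Nonempty)
open import Data.Integer using (+_)
open import Data.Rational using (ℚ; _/_; 0ℚ) renaming (_+_ to _+ℚ_)
open import Relation.Binary.PropositionalEquality using (_≡_; refl; subst; sym)

record SkewBollobas {n m : ℕ} (A B : Fin m → Subset n) : Set where
  field
    disjoint : ∀ i → Empty (A i ∩ B i)
    crossing : ∀ i j → i Data.Fin.< j → Nonempty (A i ∩ B j)

choose-pos : ∀ a b → 0 Data.Nat.< (a + b) C a
choose-pos zero b = z<s
choose-pos (suc a) zero = choose-pos-diag a
  where
  choose-pos-diag : ∀ a → 0 Data.Nat.< (suc a + zero) C suc a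
  choose-pos-diag a with choose-pos a zero
  ... | p rewrite sym (nCk+nC[k+1]≡[n+1]C[k+1] (a + zero) a) =
    <-≤-trans p (m≤m+n _ _)
choose-pos (suc a) (suc b) with choose-pos a (suc b)
... | p rewrite sym (nCk+nC[k+1]≡[n+1]C[k+1] (a + suc b) a) =
  <-≤-trans p (m≤m+n _ _)

denom : ℕ → ℕ → ℕ
denom a b = suc (a + b) * ((a + b) C a)

denom-nonZero : ∀ a b → NonZero (denom a b)
denom-nonZero a b = m*n≢0 (suc (a + b)) ((a + b) C a) {{_}} {{>-nonZero (choose-pos a b)}}

weight : ℕ → ℕ → ℚ
weight a b = ((+ 1) / denom a b) {{denom-nonZero a b}}

sumFin : ∀ {m} → (Fin m → ℚ) → ℚ
sumFin {zero} f = 0ℚ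
sumFin {suc m} f = f zero +ℚ sumFin (λ i → f (suc i))

-- With w(a, b) = 1 / ((a + b + 1) C(a + b, a)) = a! b! / (a + b + 1)! one has the
-- Pascal-type recurrence w(a, b) = w(a + 1, b) + w(a, b + 1).  Generalise the claim to families
-- in which every A i is padded with p extra points and every B i with q extra points: the sum of
-- w(p + |A i|, q + |B i|) is at most w(p, q).  Induct on the size of the ground set and split on
-- its first point x.  Pairs with x ∉ B i form a skew system on the remaining points with x moved
-- into the A-padding, pairs with x ∉ A i one with x moved into the B-padding; pairs with x in
-- neither set occur in both and are paid for by the recurrence, and no pair has x in both.  On
-- the empty ground set a skew system has at most one pair, since A 0 ∩ B 1 would be empty.
module Submission where

open import Defs
open import Data.Nat using (ℕ; _≥_; zero; suc; _+_; _*_; _!; _∸_; NonZero; s<s; z<s)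
open import Data.Fin using (Fin; zero; suc)
open import Data.Fin.Subset using (Subset; ∣_∣; inside; outside; _∩_; Empty; Nonempty)
open import Data.Rational using (_≤_; 1ℚ; ℚ; _/_; 0ℚ; toℚᵘ) renaming (_+_ to _+ℚ_)

open import Algebra.Bundles using (CommutativeMonoid)
open import Data.Empty using (⊥-elim)
open import Data.Fin.Subset.Properties using (drop-∷-Empty)
open import Data.Integer using (+_)
import Data.Integer as ℤ
import Data.Integer.Properties as ℤ
open import Data.List using (List; []; _∷_; tabulate)
open import Data.List.Relation.Unary.All using (All; []; _∷_)
open import Data.List.Relation.Unary.All.Properties using (tabulate⁺)
open import Data.Nat.Combinatorics using (_C_; nCk≡n!/k![n-k]!; k![n∸k]!∣n!)
open import Data.Nat.DivMod using (m/n*n≡m)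
open import Data.Nat.Properties
  using (+-suc; +-identityʳ; m+n∸m≡n; m≤m+n; *-assoc; *-cancelʳ-≡; *-cancelˡ-≡; _!*_!≢0;
         *-commutativeSemigroup)
open import Data.Nat.Tactic.RingSolver using (solve-∀)
open import Data.Product using (_×_; _,_)
import Data.Rational.Properties as ℚ
open import Data.Rational.Unnormalised using (ℚᵘ; mkℚᵘ; *≡*)
  renaming (_+_ to _+ᵘ_; _≃_ to _≃ᵘ_)
import Data.Rational.Unnormalised.Properties as ℚᵘ
open import Data.Vec using ([]; _∷_; here; there)
open import Function using (_∘_)
open import Relation.Binary.PropositionalEquality
  using (_≡_; refl; sym; trans; cong; cong₂; subst; module ≡-Reasoning)

open import Algebra.Properties.CommutativeSemigroup *-commutativeSemigroup
  using () renaming (x∙yz≈y∙xz to x*[y*z]≡y*[x*z])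
open import Algebra.Properties.CommutativeSemigroup
  (CommutativeMonoid.commutativeSemigroup ℚ.+-0-commutativeMonoid)
  using () renaming (x∙yz≈y∙xz to x+[y+z]≡y+[x+z]; interchange to [x+y]+[z+w]≡[x+z]+[y+w])

1/ᵘd≃1/ᵘd₁+1/ᵘd₂ : ∀ e e₁ e₂ → suc e * (suc e₁ + suc e₂) ≡ suc e₁ * suc e₂ →
                   mkℚᵘ (+ 1) e ≃ᵘ mkℚᵘ (+ 1) e₁ +ᵘ mkℚᵘ (+ 1) e₂
1/ᵘd≃1/ᵘd₁+1/ᵘd₂ e e₁ e₂ eq = *≡* (begin
  + 1 ℤ.* + (d₁ * d₂)                      ≡⟨ ℤ.*-identityˡ _ ⟩
  + (d₁ * d₂)                              ≡⟨ cong +_ (trans (sym eq) (swap d d₁ d₂)) ⟩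
  + ((d₂ + d₁) * d)                        ≡⟨ ℤ.pos-* (d₂ + d₁) d ⟩
  + (d₂ + d₁) ℤ.* + d                      ≡⟨ cong (ℤ._* + d) (ℤ.pos-+ d₂ d₁) ⟩
  (+ d₂ ℤ.+ + d₁) ℤ.* + d
    ≡⟨ cong₂ (λ x y → (x ℤ.+ y) ℤ.* + d) (ℤ.*-identityˡ (+ d₂)) (ℤ.*-identityˡ (+ d₁)) ⟨
  (+ 1 ℤ.* + d₂ ℤ.+ + 1 ℤ.* + d₁) ℤ.* + d  ∎)
  where
  open ≡-Reasoning
  d d₁ d₂ : ℕ
  d = suc e
  d₁ = suc e₁
  d₂ = suc e₂
  swap : ∀ x y z → x * (y + z) ≡ (z + y) * x
  swap = solve-∀

1/d≡1/d₁+1/d₂ : ∀ d d₁ d₂ .{{_ : NonZero d}} .{{_ : NonZero d₁}} .{{_ : NonZero d₂}} →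
                d * (d₁ + d₂) ≡ d₁ * d₂ → + 1 / d ≡ + 1 / d₁ +ℚ + 1 / d₂
1/d≡1/d₁+1/d₂ d@(suc e) d₁@(suc e₁) d₂@(suc e₂) eq = ℚ.toℚᵘ-injective (begin
  toℚᵘ (+ 1 / d)                     ≈⟨ ℚ.toℚᵘ-fromℚᵘ u ⟩
  u                                  ≈⟨ 1/ᵘd≃1/ᵘd₁+1/ᵘd₂ e e₁ e₂ eq ⟩
  u₁ +ᵘ u₂                           ≈⟨ ℚᵘ.+-cong (ℚ.toℚᵘ-fromℚᵘ u₁) (ℚ.toℚᵘ-fromℚᵘ u₂) ⟨
  toℚᵘ (+ 1 / d₁) +ᵘ toℚᵘ (+ 1 / d₂) ≈⟨ ℚ.toℚᵘ-homo-+ (+ 1 / d₁) (+ 1 / d₂) ⟨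
  toℚᵘ (+ 1 / d₁ +ℚ + 1 / d₂)        ∎)
  where
  open ℚᵘ.≃-Reasoning
  u u₁ u₂ : ℚᵘ
  u = mkℚᵘ (+ 1) e
  u₁ = mkℚᵘ (+ 1) e₁
  u₂ = mkℚᵘ (+ 1) e₂

open ≡-Reasoning

C*factorials≡! : ∀ a b → ((a + b) C a) * (a ! * b !) ≡ (a + b) !
C*factorials≡! a b = begin
  ((a + b) C a) * (a ! * b !)
    ≡⟨ cong (λ c → ((a + b) C a) * (a ! * c !)) (m+n∸m≡n a b) ⟨
  ((a + b) C a) * (a ! * (a + b ∸ a) !)
    ≡⟨ cong (_* (a ! * (a + b ∸ a) !)) (nCk≡n!/k![n-k]! (m≤m+n a b)) ⟩
  _ ≡⟨ m/n*n≡m {{a !* (a + b ∸ a) !≢0}} (k![n∸k]!∣n! (m≤m+n a b)) ⟩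
  (a + b) !
    ∎

C-absorptionˡ : ∀ a b → suc a * ((suc a + b) C suc a) ≡ suc (a + b) * ((a + b) C a)
C-absorptionˡ a b = *-cancelʳ-≡ _ _ (a ! * b !) {{a !* b !≢0}} (begin
  suc a * ((suc a + b) C suc a) * (a ! * b !)   ≡⟨ shuffle (suc a) ((suc a + b) C suc a) (a !) (b !) ⟩
  ((suc a + b) C suc a) * (suc a ! * b !)       ≡⟨ C*factorials≡! (suc a) b ⟩
  suc (a + b) * (a + b) !                       ≡⟨ cong (suc (a + b) *_) (C*factorials≡! a b) ⟨
  suc (a + b) * (((a + b) C a) * (a ! * b !))   ≡⟨ *-assoc (suc (a + b)) ((a + b) C a) (a ! * b !) ⟨
  suc (a + b) * ((a + b) C a) * (a ! * b !)     ∎)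
  where
  shuffle : ∀ x c u v → x * c * (u * v) ≡ c * ((x * u) * v)
  shuffle = solve-∀

C-absorptionʳ : ∀ a b → suc b * ((a + suc b) C a) ≡ suc (a + b) * ((a + b) C a)
C-absorptionʳ a b = *-cancelʳ-≡ _ _ (a ! * b !) {{a !* b !≢0}} (begin
  suc b * ((a + suc b) C a) * (a ! * b !)       ≡⟨ shuffle (suc b) ((a + suc b) C a) (a !) (b !) ⟩
  ((a + suc b) C a) * (a ! * suc b !)           ≡⟨ C*factorials≡! a (suc b) ⟩
  (a + suc b) !                                 ≡⟨ cong _! (+-suc a b) ⟩
  suc (a + b) * (a + b) !                       ≡⟨ cong (suc (a + b) *_) (C*factorials≡! a b) ⟨
  suc (a + b) * (((a + b) C a) * (a ! * b !))   ≡⟨ *-assoc (suc (a + b)) ((a + b) C a) (a ! * b !) ⟨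
  suc (a + b) * ((a + b) C a) * (a ! * b !)     ∎)
  where
  shuffle : ∀ x c u v → x * c * (u * v) ≡ c * (u * (x * v))
  shuffle = solve-∀

denom-sucˡ : ∀ a b → suc a * denom (suc a) b ≡ suc (suc (a + b)) * denom a b
denom-sucˡ a b = begin
  suc a * (suc (suc a + b) * ((suc a + b) C suc a))
    ≡⟨ x*[y*z]≡y*[x*z] (suc a) (suc (suc a + b)) ((suc a + b) C suc a) ⟩
  suc (suc a + b) * (suc a * ((suc a + b) C suc a))
    ≡⟨ cong (suc (suc (a + b)) *_) (C-absorptionˡ a b) ⟩
  suc (suc (a + b)) * denom a b
    ∎

denom-sucʳ : ∀ a b → suc b * denom a (suc b) ≡ suc (suc (a + b)) * denom a b
denom-sucʳ a b = begin
  suc b * (suc (a + suc b) * ((a + suc b) C a))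
    ≡⟨ x*[y*z]≡y*[x*z] (suc b) (suc (a + suc b)) ((a + suc b) C a) ⟩
  suc (a + suc b) * (suc b * ((a + suc b) C a))
    ≡⟨ cong₂ _*_ (cong suc (+-suc a b)) (C-absorptionʳ a b) ⟩
  suc (suc (a + b)) * denom a b
    ∎

denom-pascal : ∀ a b → denom a b * (denom (suc a) b + denom a (suc b)) ≡ denom (suc a) b * denom a (suc b)
denom-pascal a b = *-cancelˡ-≡ _ _ (suc a * suc b) (begin
  suc a * suc b * (D * (Dˡ + Dʳ))
    ≡⟨ expand (suc a) (suc b) D Dˡ Dʳ ⟩
  D * (suc b * (suc a * Dˡ) + suc a * (suc b * Dʳ))
    ≡⟨ cong₂ (λ x y → D * (suc b * x + suc a * y)) (denom-sucˡ a b) (denom-sucʳ a b) ⟩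
  D * (suc b * (M * D) + suc a * (M * D))
    ≡⟨ collect a b D ⟩
  (M * D) * (M * D)
    ≡⟨ cong₂ _*_ (denom-sucˡ a b) (denom-sucʳ a b) ⟨
  (suc a * Dˡ) * (suc b * Dʳ)
    ≡⟨ regroup (suc a) (suc b) Dˡ Dʳ ⟩
  suc a * suc b * (Dˡ * Dʳ)
    ∎)
  where
  D Dˡ Dʳ M : ℕ
  D = denom a b
  Dˡ = denom (suc a) b
  Dʳ = denom a (suc b)
  M = suc (suc (a + b))
  expand : ∀ x y d dˡ dʳ → x * y * (d * (dˡ + dʳ)) ≡ d * (y * (x * dˡ) + x * (y * dʳ))
  expand = solve-∀
  collect : ∀ a b d → d * (suc b * (suc (suc (a + b)) * d) + suc a * (suc (suc (a + b)) * d))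
                    ≡ (suc (suc (a + b)) * d) * (suc (suc (a + b)) * d)
  collect = solve-∀
  regroup : ∀ x y dˡ dʳ → (x * dˡ) * (y * dʳ) ≡ x * y * (dˡ * dʳ)
  regroup = solve-∀

weight-pascal : ∀ a b → weight a b ≡ weight (suc a) b +ℚ weight a (suc b)
weight-pascal a b =
  1/d≡1/d₁+1/d₂ (denom a b) (denom (suc a) b) (denom a (suc b))
    {{denom-nonZero a b}} {{denom-nonZero (suc a) b}} {{denom-nonZero a (suc b)}}
    (denom-pascal a b)

weight-nonNegative : ∀ a b → 0ℚ ≤ weight a b
weight-nonNegative a b =
  ℚ.nonNegative⁻¹ (weight a b) {{ℚ.normalize-nonNeg 1 (denom a b) {{denom-nonZero a b}}}}

Pair : ℕ → Set
Pair n = Subset n × Subset n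

Crosses : ∀ {n} → Subset n → Pair n → Set
Crosses a (_ , b) = Nonempty (a ∩ b)

data Skew {n : ℕ} : List (Pair n) → Set where
  []     : Skew []
  skew-∷ : ∀ {a b ps} → Empty (a ∩ b) → All (Crosses a) ps → Skew ps → Skew ((a , b) ∷ ps)

-- The pairs that stay disjoint when the first point is added to the A-set (resp. B-set),
-- restricted to the remaining points.
pushFirstIntoA : ∀ {n} → List (Pair (suc n)) → List (Pair n)
pushFirstIntoA [] = []
pushFirstIntoA ((_ ∷ a , inside ∷ b) ∷ ps) = pushFirstIntoA ps
pushFirstIntoA ((_ ∷ a , outside ∷ b) ∷ ps) = (a , b) ∷ pushFirstIntoA ps

pushFirstIntoB : ∀ {n} → List (Pair (suc n)) → List (Pair n)
pushFirstIntoB [] = []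
pushFirstIntoB ((inside ∷ a , _ ∷ b) ∷ ps) = pushFirstIntoB ps
pushFirstIntoB ((outside ∷ a , _ ∷ b) ∷ ps) = (a , b) ∷ pushFirstIntoB ps

Nonempty-drop-outside : ∀ {n} {p : Subset n} → Nonempty (outside ∷ p) → Nonempty p
Nonempty-drop-outside (suc i , there i∈p) = i , i∈p

All-Crosses-pushFirstIntoA : ∀ {n} x (a : Subset n) ps →
                             All (Crosses (x ∷ a)) ps → All (Crosses a) (pushFirstIntoA ps)
All-Crosses-pushFirstIntoA x a [] [] = []
All-Crosses-pushFirstIntoA x a ((_ ∷ _ , inside ∷ _) ∷ ps) (_ ∷ cs) =
  All-Crosses-pushFirstIntoA x a ps cs
All-Crosses-pushFirstIntoA inside a ((_ ∷ _ , outside ∷ _) ∷ ps) (c ∷ cs) =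
  Nonempty-drop-outside c ∷ All-Crosses-pushFirstIntoA inside a ps cs
All-Crosses-pushFirstIntoA outside a ((_ ∷ _ , outside ∷ _) ∷ ps) (c ∷ cs) =
  Nonempty-drop-outside c ∷ All-Crosses-pushFirstIntoA outside a ps cs

All-Crosses-pushFirstIntoB : ∀ {n} (a : Subset n) ps →
                             All (Crosses (outside ∷ a)) ps → All (Crosses a) (pushFirstIntoB ps)
All-Crosses-pushFirstIntoB a [] [] = []
All-Crosses-pushFirstIntoB a ((inside ∷ _ , _ ∷ _) ∷ ps) (_ ∷ cs) =
  All-Crosses-pushFirstIntoB a ps cs
All-Crosses-pushFirstIntoB a ((outside ∷ _ , _ ∷ _) ∷ ps) (c ∷ cs) =
  Nonempty-drop-outside c ∷ All-Crosses-pushFirstIntoB a ps cs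

Skew-pushFirstIntoA : ∀ {n} (ps : List (Pair (suc n))) → Skew ps → Skew (pushFirstIntoA ps)
Skew-pushFirstIntoA [] [] = []
Skew-pushFirstIntoA ((_ ∷ a , inside ∷ b) ∷ ps) (skew-∷ _ _ s) = Skew-pushFirstIntoA ps s
Skew-pushFirstIntoA ((x ∷ a , outside ∷ b) ∷ ps) (skew-∷ d c s) =
  skew-∷ (drop-∷-Empty d) (All-Crosses-pushFirstIntoA x a ps c) (Skew-pushFirstIntoA ps s)

Skew-pushFirstIntoB : ∀ {n} (ps : List (Pair (suc n))) → Skew ps → Skew (pushFirstIntoB ps)
Skew-pushFirstIntoB [] [] = []
Skew-pushFirstIntoB ((inside ∷ a , _ ∷ b) ∷ ps) (skew-∷ _ _ s) = Skew-pushFirstIntoB ps s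
Skew-pushFirstIntoB ((outside ∷ a , _ ∷ b) ∷ ps) (skew-∷ d c s) =
  skew-∷ (drop-∷-Empty d) (All-Crosses-pushFirstIntoB a ps c) (Skew-pushFirstIntoB ps s)

-- Every A-set is padded with p points and every B-set with q points outside the ground set.
weightSum : ∀ {n} → ℕ → ℕ → List (Pair n) → ℚ
weightSum p q [] = 0ℚ
weightSum p q ((a , b) ∷ ps) = weight (p + ∣ a ∣) (q + ∣ b ∣) +ℚ weightSum p q ps

weightSum-split : ∀ {n} p q (ps : List (Pair (suc n))) → Skew ps →
                  weightSum p q ps ≡
                  weightSum (suc p) q (pushFirstIntoA ps) +ℚ weightSum p (suc q) (pushFirstIntoB ps)
weightSum-split p q [] [] = refl
weightSum-split p q ((inside ∷ a , inside ∷ b) ∷ ps) (skew-∷ disjoint _ _) =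
  ⊥-elim (disjoint (zero , here))
weightSum-split p q ((inside ∷ a , outside ∷ b) ∷ ps) (skew-∷ _ _ s) = begin
  weight (p + suc ∣ a ∣) (q + ∣ b ∣) +ℚ weightSum p q ps
    ≡⟨ cong₂ _+ℚ_ (cong (λ c → weight c (q + ∣ b ∣)) (+-suc p ∣ a ∣)) (weightSum-split p q ps s) ⟩
  w +ℚ (Sᴬ +ℚ Sᴮ)
    ≡⟨ ℚ.+-assoc w Sᴬ Sᴮ ⟨
  (w +ℚ Sᴬ) +ℚ Sᴮ
    ∎
  where
  w Sᴬ Sᴮ : ℚ
  w = weight (suc p + ∣ a ∣) (q + ∣ b ∣)
  Sᴬ = weightSum (suc p) q (pushFirstIntoA ps)
  Sᴮ = weightSum p (suc q) (pushFirstIntoB ps)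
weightSum-split p q ((outside ∷ a , inside ∷ b) ∷ ps) (skew-∷ _ _ s) = begin
  weight (p + ∣ a ∣) (q + suc ∣ b ∣) +ℚ weightSum p q ps
    ≡⟨ cong₂ _+ℚ_ (cong (weight (p + ∣ a ∣)) (+-suc q ∣ b ∣)) (weightSum-split p q ps s) ⟩
  w +ℚ (Sᴬ +ℚ Sᴮ)
    ≡⟨ x+[y+z]≡y+[x+z] w Sᴬ Sᴮ ⟩
  Sᴬ +ℚ (w +ℚ Sᴮ)
    ∎
  where
  w Sᴬ Sᴮ : ℚ
  w = weight (p + ∣ a ∣) (suc q + ∣ b ∣)
  Sᴬ = weightSum (suc p) q (pushFirstIntoA ps)
  Sᴮ = weightSum p (suc q) (pushFirstIntoB ps)
weightSum-split p q ((outside ∷ a , outside ∷ b) ∷ ps) (skew-∷ _ _ s) = begin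
  weight (p + ∣ a ∣) (q + ∣ b ∣) +ℚ weightSum p q ps
    ≡⟨ cong₂ _+ℚ_ (weight-pascal (p + ∣ a ∣) (q + ∣ b ∣)) (weightSum-split p q ps s) ⟩
  (wᴬ +ℚ wᴮ) +ℚ (Sᴬ +ℚ Sᴮ)
    ≡⟨ [x+y]+[z+w]≡[x+z]+[y+w] wᴬ wᴮ Sᴬ Sᴮ ⟩
  (wᴬ +ℚ Sᴬ) +ℚ (wᴮ +ℚ Sᴮ)
    ∎
  where
  wᴬ wᴮ Sᴬ Sᴮ : ℚ
  wᴬ = weight (suc p + ∣ a ∣) (q + ∣ b ∣)
  wᴮ = weight (p + ∣ a ∣) (suc q + ∣ b ∣)
  Sᴬ = weightSum (suc p) q (pushFirstIntoA ps)
  Sᴮ = weightSum p (suc q) (pushFirstIntoB ps)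

weightSum≤weight : ∀ n p q (ps : List (Pair n)) → Skew ps → weightSum p q ps ≤ weight p q
weightSum≤weight zero p q [] [] = weight-nonNegative p q
weightSum≤weight zero p q (([] , []) ∷ []) _ =
  ℚ.≤-reflexive (trans (ℚ.+-identityʳ _) (cong₂ weight (+-identityʳ p) (+-identityʳ q)))
weightSum≤weight zero p q (_ ∷ _ ∷ _) (skew-∷ _ ((() , _) ∷ _) _)
weightSum≤weight (suc n) p q ps s =
  ℚ.≤-trans (ℚ.≤-reflexive (weightSum-split p q ps s))
    (ℚ.≤-trans (ℚ.+-mono-≤ boundᴬ boundᴮ) (ℚ.≤-reflexive (sym (weight-pascal p q))))
  where
  boundᴬ : weightSum (suc p) q (pushFirstIntoA ps) ≤ weight (suc p) q
  boundᴬ = weightSum≤weight n (suc p) q (pushFirstIntoA ps) (Skew-pushFirstIntoA ps s)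
  boundᴮ : weightSum p (suc q) (pushFirstIntoB ps) ≤ weight p (suc q)
  boundᴮ = weightSum≤weight n p (suc q) (pushFirstIntoB ps) (Skew-pushFirstIntoB ps s)

sumFin≡weightSum : ∀ {n m} (A B : Fin m → Subset n) →
                   sumFin (λ i → weight ∣ A i ∣ ∣ B i ∣) ≡ weightSum 0 0 (tabulate (λ i → A i , B i))
sumFin≡weightSum {m = zero} A B = refl
sumFin≡weightSum {m = suc m} A B =
  cong (weight ∣ A zero ∣ ∣ B zero ∣ +ℚ_) (sumFin≡weightSum (A ∘ suc) (B ∘ suc))

SkewBollobas-tail : ∀ {n m} {A B : Fin (suc m) → Subset n} →
                    SkewBollobas A B → SkewBollobas (A ∘ suc) (B ∘ suc)
SkewBollobas-tail S = record
  { disjoint = disjoint ∘ suc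
  ; crossing = λ i j i<j → crossing (suc i) (suc j) (s<s i<j)
  }
  where open SkewBollobas S

SkewBollobas⇒Skew : ∀ {n m} {A B : Fin m → Subset n} →
                    SkewBollobas A B → Skew (tabulate (λ i → A i , B i))
SkewBollobas⇒Skew {m = zero} _ = []
SkewBollobas⇒Skew {m = suc m} S =
  skew-∷ (disjoint zero) (tabulate⁺ (λ j → crossing zero (suc j) z<s))
         (SkewBollobas⇒Skew (SkewBollobas-tail S))
  where open SkewBollobas S

-- weight 0 0 computes to 1ℚ.
theorem1p5 : (n m : ℕ) → n ≥ 1 → m ≥ 1 → (A B : Fin m → Subset n) →
    SkewBollobas A B →
    sumFin (λ i → weight ∣ A i ∣ ∣ B i ∣) ≤ 1ℚ
theorem1p5 n m _ _ A B S =
  subst (_≤ 1ℚ) (sym (sumFin≡weightSum A B))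
    (weightSum≤weight n 0 0 (tabulate (λ i → A i , B i)) (SkewBollobas⇒Skew S))
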